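{- Let $G=(V,E)$ be an $S_3$-graph and $x_0\in V$. A set $K\subseteq V$ belongs to ${\rm Max}(\Upsilon_{x_0})$ if and only if $K$ is a facet (maximal by inclusion member) of $\Upsilon_{x_0}$ satisfying the following condition: for any $y\in V\setminus K$ such that $R:=(y/x_0)\cap K\ne \varnothing$, we have $x_0\in \mathrm{conv}((K\setminus R)\cup \{ y\})$.
   Context: $G=(V,E)$ is a connected graph with geodesic convexity: a set is convex if it contains the interval $[u,v]=\{w: d(u,w)+d(w,v)=d(u,v)\}$ for any two of its vertices, and $\mathrm{conv}(A)$ denotes the smallest convex set containing $A$. $G$ is an $S_3$-graph if any convex set and any vertex not in it can be separated by complementary halfspaces (convex sets with convex complements). For sets $A,B$, the shadow is $A/B=\{x\in V: \mathrm{conv}(B\cup\{x\})\cap A\ne\varnothing\}$; for a single vertex we write $y/x_0$ for $\{y\}/\{x_0\}$, and $K'/x_0=\bigcup_{y\in K'} y/x_0$. The imprint of $x_0$ on $A$ is $\mathrm{Imp}_{x_0}(A)=\{z\in A: [x_0,z]\cap A=\{z\}\}$. A set $K\subseteq V$ is $x_0$-proximal if $\mathrm{Imp}_{x_0}(K)=K$ and $x_0\notin \mathrm{conv}(K)$; $\Upsilon_{x_0}$ denotes the family of all $x_0$-proximal sets, which is a simplicial complex on $V\setminus\{x_0\}$ (closed under taking subsets). On $\Upsilon_{x_0}$ define the partial order $K\preceq_{x_0} K'$ iff $K\subseteq K'/x_0$; ${\rm Max}(\Upsilon_{x_0})$ is the set of maximal elements of $(\Upsilon_{x_0},\preceq_{x_0})$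 (maximal $x_0$-proximal sets). -}

module Defs where

open import Level using (Level; _⊔_) renaming (zero to 0ℓ; suc to lsuc)
open import Data.Nat using (ℕ; zero; suc; _+_; _≤_)
open import Data.Product using (Σ; ∃; _×_; _,_)
open import Data.Sum using (_⊎_)
open import Relation.Nullary using (¬_)
open import Relation.Binary.PropositionalEquality using (_≡_)

record Graph : Set₁ where
  field
    V     : Set
    Adj   : V → V → Set
    sym   : ∀ {u v} → Adj u v → Adj v u
    irrefl : ∀ {u} → ¬ Adj u u

module GraphTheory (G : Graph) where
  open Graph G public

  data Walk : V → V → ℕ → Set where
    nil  : ∀ {u} → Walk u u zero
    cons : ∀ {u w v n} → Adj u w → Walk w v n → Walk u v (suc n)

  Connected : Set
  Connected = ∀ u v → ∃ λ n → Walk u v n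

  Dist : V → V → ℕ → Set
  Dist u v n = Walk u v n × (∀ m → Walk u v m → n ≤ m)

  _∈_ : ∀ {ℓ} → V → (V → Set ℓ) → Set ℓ
  x ∈ A = A x

  _⊆_ : ∀ {ℓ ℓ'} → (V → Set ℓ) → (V → Set ℓ') → Set (ℓ ⊔ ℓ')
  A ⊆ B = ∀ x → A x → B x

  Interval : V → V → V → Set
  Interval u v w = ∃ λ a → ∃ λ b → Dist u w a × Dist w v (b) × Dist u v (a + b)

  Convex : (V → Set) → Set
  Convex C = ∀ u v → C u → C v → Interval u v ⊆ C

  conv : ∀ {ℓ} → (V → Set ℓ) → V → Set (lsuc 0ℓ ⊔ ℓ)
  conv A x = (C : V → Set) → Convex C → A ⊆ C → C x

  Halfspace : (V → Set) → Set
  Halfspace H = Convex H × Convex (λ x → ¬ H x)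

  S3 : Set₁
  S3 = ∀ (C : V → Set) (v : V) → Convex C → ¬ C v →
       Σ (V → Set) λ H → Halfspace H × C ⊆ H × ¬ H v

  -- shadow y/x0 = { x : conv({x0} ∪ {x}) ∩ {y} ≠ ∅ } = { x : y ∈ conv{x0,x} }
  shadow : V → V → V → Set₁
  shadow y x0 x = conv (λ z → (z ≡ x0) ⊎ (z ≡ x)) y

  shadowSet : (V → Set) → V → V → Set₁
  shadowSet K' x0 x = ∃ λ y → K' y × shadow y x0 x

  Imp : V → (V → Set) → V → Set
  Imp x0 A z = A z × (∀ w → Interval x0 z w → A w → w ≡ z)

  Proximal : V → (V → Set) → Set₁
  Proximal x0 K = (K ⊆ Imp x0 K) × (Imp x0 K ⊆ K) × ¬ conv K x0

  _⪯[_]_ : (V → Set) → V → (V → Set) → Set₁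
  K ⪯[ x0 ] K' = K ⊆ shadowSet K' x0

  InMax : V → (V → Set) → Set₁
  InMax x0 K = Proximal x0 K × (∀ K' → Proximal x0 K' → K ⪯[ x0 ] K' → K' ⪯[ x0 ] K)

  Facet : V → (V → Set) → Set₁
  Facet x0 K = Proximal x0 K × (∀ K' → Proximal x0 K' → K ⊆ K' → K' ⊆ K)

  Condition : V → (V → Set) → Set₁
  Condition x0 K =
    ∀ y → ¬ K y →
    (∃ λ z → K z × shadow y x0 z) →
    conv (λ u → (K u × ¬ shadow y x0 u) ⊎ (u ≡ y)) x0

{-# OPTIONS --safe #-}
module Submission where

open import Defs
open import Axiom.ExcludedMiddle using (ExcludedMiddle)
open import Axiom.DoubleNegationElimination using (em⇒dne)
open import Level using (_⊔_; Lift; lift; lower) renaming (suc to lsuc; zero to 0ℓ)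
open import Data.Product using (_×_; Σ; ∃; _,_; proj₁; proj₂)
open import Data.Sum using (_⊎_; inj₁; inj₂; swap)
open import Data.Empty using (⊥-elim)
open import Data.Nat using (ℕ; zero; suc; _+_; _≤_; _<_; s≤s⁻¹)
open import Data.Nat.Properties
open import Data.Nat.Induction using (<-rec)
open import Function using (_∘_)
open import Function.Bundles using (_⇔_; mk⇔)
open import Relation.Nullary using (¬_; Dec; yes; no)
open import Relation.Nullary.Decidable using (map′; decidable-stable)
open import Relation.Binary.PropositionalEquality
  using (_≡_; refl; sym; trans; cong; cong₂; subst; subst₂; module ≡-Reasoning)

-- In an S₃-graph intervals are convex: if a vertex w ∈ conv{u,x} adjacent to an inner
-- vertex a of [u,x] were outside [u,x], halfspaces separating w from [u,a] and from [a,x]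
-- (convex by induction on d(u,x)) would force d(u,w) = d(u,a) and d(w,x) = d(a,x).
-- Hence y/x₀ = {z : y ∈ [x₀,z]}.  A maximal K is a facet, since K ⊆ K' gives K ⪯ K'
-- and then K' ⪯ K together with the imprint property of K' yields K' ⊆ K.  It satisfies
-- the condition, since otherwise (K ∖ R) ∪ {y} would be an x₀-proximal set above K,
-- forcing y ∈ K.  Conversely, if K ⪯ K' with K' proximal, a halfspace H ⊇ K' avoiding x₀
-- also contains K; for y ∈ K' outside K/x₀ the condition then forces R = ∅, and K ∪ {y}
-- is proximal, contradicting that K is a facet.

em-lower : ∀ {a} b → ExcludedMiddle (a ⊔ b) → ExcludedMiddle a
em-lower b em = map′ lower lift (em {Lift b _})

adjacent-trichotomy : ∀ {m n} → m ≤ suc n → n ≤ suc m → m ≡ suc n ⊎ suc m ≡ n ⊎ m ≡ n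
adjacent-trichotomy m≤1+n n≤1+m with m≤n⇒m<n∨m≡n m≤1+n | m≤n⇒m<n∨m≡n n≤1+m
... | inj₂ m≡1+n | _          = inj₁ m≡1+n
... | _          | inj₂ n≡1+m = inj₂ (inj₁ (sym n≡1+m))
... | inj₁ m<1+n | inj₁ n<1+m = inj₂ (inj₂ (≤-antisym (s≤s⁻¹ m<1+n) (s≤s⁻¹ n<1+m)))

module Walks (G : Graph) where
  open GraphTheory G renaming (sym to Adj-sym)

  snoc : ∀ {u v w n} → Walk u v n → Adj v w → Walk u w (suc n)
  snoc nil        b = cons b nil
  snoc (cons a p) b = cons a (snoc p b)

  reverse : ∀ {u v n} → Walk u v n → Walk v u n
  reverse nil        = nil
  reverse (cons a p) = snoc (reverse p) (Adj-sym a)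

  _++_ : ∀ {u v w m n} → Walk u v m → Walk v w n → Walk u w (m + n)
  nil      ++ q = q
  cons a p ++ q = cons a (p ++ q)

module Convexity (G : Graph) where
  open GraphTheory G

  data Hull (A : V → Set) : V → Set where
    hull-base : ∀ {x} → A x → Hull A x
    hull-step : ∀ {a b w} → Hull A a → Hull A b → Interval a b w → Hull A w

  Hull-convex : ∀ {A} → Convex (Hull A)
  Hull-convex _ _ ha hb _ w∈ = hull-step ha hb w∈

  Hull⊆conv : ∀ {A} → Hull A ⊆ conv A
  Hull⊆conv _ (hull-base Ax)       C C-convex A⊆C = A⊆C _ Ax
  Hull⊆conv w (hull-step ha hb w∈) C C-convex A⊆C =
    C-convex _ _ (Hull⊆conv _ ha C C-convex A⊆C) (Hull⊆conv _ hb C C-convex A⊆C) w w∈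

  separate-from-conv : S3 → ∀ {A x} → ¬ conv A x →
                       Σ (V → Set) λ H → Halfspace H × A ⊆ H × ¬ H x
  separate-from-conv s3 {A} {x} x∉ with s3 (Hull A) x Hull-convex (x∉ ∘ Hull⊆conv x)
  ... | H , H-half , Hull⊆H , x∉H = H , H-half , (λ z → Hull⊆H z ∘ hull-base) , x∉H

  conv-mono : ∀ {ℓ ℓ'} {A : V → Set ℓ} {B : V → Set ℓ'} → A ⊆ B → conv A ⊆ conv B
  conv-mono A⊆B x x∈ C C-convex B⊆C = x∈ C C-convex (λ z → B⊆C z ∘ A⊆B z)

  conv-convex : ∀ {ℓ} {A : V → Set ℓ} {a b w} →
                conv A a → conv A b → Interval a b w → conv A w
  conv-convex a∈ b∈ w∈ C C-convex A⊆C =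
    C-convex _ _ (a∈ C C-convex A⊆C) (b∈ C C-convex A⊆C) _ w∈

  pair⊆ : ∀ {C : V → Set} {u x} → C u → C x → (λ z → z ≡ u ⊎ z ≡ x) ⊆ C
  pair⊆ Cu Cx _ (inj₁ refl) = Cu
  pair⊆ Cu Cx _ (inj₂ refl) = Cx

  shadow-elim : ∀ {C w u x} → shadow w u x → Convex C → C u → C x → C w
  shadow-elim w∈ C-convex Cu Cx = w∈ _ C-convex (pair⊆ Cu Cx)

  shadow-refl : ∀ {x0 z} → shadow z x0 z
  shadow-refl C C-convex pair⊆C = pair⊆C _ (inj₂ refl)

  shadow-swap : ∀ {w u x} → shadow w u x → shadow w x u
  shadow-swap w∈ C C-convex pair⊆C = w∈ C C-convex (λ z → pair⊆C z ∘ swap)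

  shadow-trans : ∀ {k y x0 z} → shadow k x0 y → shadow y x0 z → shadow k x0 z
  shadow-trans k∈ y∈ C C-convex pair⊆C =
    shadow-elim k∈ C-convex (pair⊆C _ (inj₁ refl)) (y∈ C C-convex pair⊆C)

  interval⇒shadow : ∀ {u x w} → Interval u x w → shadow w u x
  interval⇒shadow w∈ C C-convex pair⊆C =
    C-convex _ _ (pair⊆C _ (inj₁ refl)) (pair⊆C _ (inj₂ refl)) _ w∈

module Metric (G : Graph) (em : ExcludedMiddle 0ℓ) (conn : GraphTheory.Connected G) where
  open GraphTheory G renaming (sym to Adj-sym)
  open Walks G
  open Convexity G

  shortest : ∀ {u v} n → Walk u v n → ∃ (Dist u v)
  shortest {u} {v} = <-rec (λ n → Walk u v n → ∃ (Dist u v)) shorten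
    where
    shorten : ∀ n → (∀ {m} → m < n → Walk u v m → ∃ (Dist u v)) →
              Walk u v n → ∃ (Dist u v)
    shorten n rec p with em {∃ λ m → m < n × Walk u v m}
    ... | yes (m , m<n , q) = rec m<n q
    ... | no ∄shorter      = n , p , λ m q → ≮⇒≥ λ m<n → ∄shorter (m , m<n , q)

  d : V → V → ℕ
  d u v = proj₁ (shortest _ (proj₂ (conn u v)))

  d-walk : ∀ {u v} → Walk u v (d u v)
  d-walk {u} {v} = proj₁ (proj₂ (shortest _ (proj₂ (conn u v))))

  d-minimal : ∀ {u v m} → Walk u v m → d u v ≤ m
  d-minimal {u} {v} {m} p = proj₂ (proj₂ (shortest _ (proj₂ (conn u v)))) m p

  Dist⇒≡d : ∀ {u v n} → Dist u v n → n ≡ d u v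
  Dist⇒≡d (p , n-minimal) = ≤-antisym (n-minimal _ d-walk) (d-minimal p)

  d-Dist : ∀ {u v} → Dist u v (d u v)
  d-Dist = d-walk , λ _ → d-minimal

  d≡0⇒≡ : ∀ {u v} → d u v ≡ 0 → u ≡ v
  d≡0⇒≡ {u} {v} e with subst (Walk u v) e d-walk
  ... | nil = refl

  d-refl : ∀ {u} → d u u ≡ 0
  d-refl = n≤0⇒n≡0 (d-minimal nil)

  d-sym : ∀ {u v} → d u v ≡ d v u
  d-sym = ≤-antisym (d-minimal (reverse d-walk)) (d-minimal (reverse d-walk))

  d-triangle : ∀ {u v w} → d u w ≤ d u v + d v w
  d-triangle = d-minimal (d-walk ++ d-walk)

  d-adj : ∀ {u v} → Adj u v → d u v ≡ 1
  d-adj {u} uv = ≤-antisym (d-minimal (cons uv nil)) (n≢0⇒n>0 d≢0)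
    where
    d≢0 : ¬ d u _ ≡ 0
    d≢0 e = irrefl (subst (Adj u) (sym (d≡0⇒≡ e)) uv)

  d-step : ∀ {u a w} → Adj a w → d u a + d a w ≡ suc (d u a)
  d-step {u} {a} aw = trans (cong (d u a +_) (d-adj aw)) (+-comm (d u a) 1)

  d-neighbour : ∀ {u a w} → Adj a w → d u w ≤ suc (d u a)
  d-neighbour aw = ≤-trans d-triangle (≤-reflexive (d-step aw))

  neighbour-trichotomy : ∀ {u a w} → Adj a w →
                         d u w ≡ suc (d u a) ⊎ suc (d u w) ≡ d u a ⊎ d u w ≡ d u a
  neighbour-trichotomy aw = adjacent-trichotomy (d-neighbour aw) (d-neighbour (Adj-sym aw))

  geodesic-step : ∀ {a w k} → d a w ≡ suc k → ∃ λ a' → Adj a a' × d a' w ≡ k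
  geodesic-step {a} {w} {k} e with subst (Walk a w) e d-walk
  ... | cons {w = a'} aa' p = a' , aa' , ≤-antisym (d-minimal p) (s≤s⁻¹ 1+k≤1+d)
    where
    open ≤-Reasoning
    1+k≤1+d : suc k ≤ suc (d a' w)
    1+k≤1+d = begin
      suc k             ≡⟨ sym e ⟩
      d a w             ≤⟨ d-triangle ⟩
      d a a' + d a' w   ≡⟨ cong (_+ d a' w) (d-adj aa') ⟩
      suc (d a' w)      ∎

  Between : V → V → V → Set
  Between u x w = d u w + d w x ≡ d u x

  interval⇒between : ∀ {u x w} → Interval u x w → Between u x w
  interval⇒between (_ , _ , uw , wx , ux) =
    trans (sym (cong₂ _+_ (Dist⇒≡d uw) (Dist⇒≡d wx))) (Dist⇒≡d ux)

  between⇒interval : ∀ {u x w} → Between u x w → Interval u x w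
  between⇒interval w∈ = _ , _ , d-Dist , d-Dist , subst (Dist _ _) (sym w∈) d-Dist

  between? : ∀ u x w → Dec (Between u x w)
  between? u x w = d u w + d w x ≟ d u x

  between-left : ∀ {u x} → Between u x u
  between-left {u} {x} = cong (_+ d u x) d-refl

  between-right : ∀ {u x} → Between u x x
  between-right {u} {x} = trans (cong (d u x +_) d-refl) (+-identityʳ (d u x))

  between-sym : ∀ {u x w} → Between u x w → Between x u w
  between-sym {u} {x} {w} w∈ = begin
    d x w + d w u  ≡⟨ +-comm (d x w) (d w u) ⟩
    d w u + d x w  ≡⟨ cong₂ _+_ (d-sym {w}) (d-sym {x}) ⟩
    d u w + d w x  ≡⟨ w∈ ⟩
    d u x          ≡⟨ d-sym ⟩
    d x u          ∎
    where open ≡-Reasoning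

  between-trans : ∀ {u x b w} → Between u x b → Between u b w → Between u x w
  between-trans {u} {x} {b} {w} b∈ w∈ = ≤-antisym ≤d d-triangle
    where
    open ≤-Reasoning
    ≤d : d u w + d w x ≤ d u x
    ≤d = begin
      d u w + d w x            ≤⟨ +-monoʳ-≤ (d u w) d-triangle ⟩
      d u w + (d w b + d b x)  ≡⟨ sym (+-assoc (d u w) _ _) ⟩
      d u w + d w b + d b x    ≡⟨ cong (_+ d b x) w∈ ⟩
      d u b + d b x            ≡⟨ b∈ ⟩
      d u x                    ∎

  between-shift : ∀ {u x b w} → Between u b w → Between u x b → Between w x b
  between-shift {u} {x} {b} {w} w∈ b∈ = ≤-antisym (+-cancelˡ-≤ (d u w) _ _ ≤d) d-triangle
    where
    open ≤-Reasoning
    ≤d : d u w + (d w b + d b x) ≤ d u w + d w x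
    ≤d = begin
      d u w + (d w b + d b x)  ≡⟨ sym (+-assoc (d u w) _ _) ⟩
      d u w + d w b + d b x    ≡⟨ cong (_+ d b x) w∈ ⟩
      d u b + d b x            ≡⟨ b∈ ⟩
      d u x                    ≤⟨ d-triangle ⟩
      d u w + d w x            ∎

  between-antisym : ∀ {x0 y z} → Between x0 z y → Between x0 y z → y ≡ z
  between-antisym {x0} {y} {z} y∈ z∈ =
    d≡0⇒≡ (m+n≡0⇒m≡0 (d y z) (+-cancelˡ-≡ (d x0 y) _ _ loop))
    where
    open ≡-Reasoning
    loop : d x0 y + (d y z + d z y) ≡ d x0 y + 0
    loop = begin
      d x0 y + (d y z + d z y)  ≡⟨ sym (+-assoc (d x0 y) _ _) ⟩
      d x0 y + d y z + d z y    ≡⟨ cong (_+ d z y) y∈ ⟩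
      d x0 z + d z y            ≡⟨ z∈ ⟩
      d x0 y                    ≡⟨ sym (+-identityʳ (d x0 y)) ⟩
      d x0 y + 0                ∎

  convex-by-steps : (C : V → Set) →
                    (∀ {a b a'} → C a → C b → Adj a a' → Between a b a' → C a') → Convex C
  convex-by-steps C step a b Ca Cb w w∈ = follow (d a w) refl Ca (interval⇒between w∈)
    where
    follow : ∀ n {c} → d c w ≡ n → C c → Between c b w → C w
    follow zero    e Cc _ = subst C (d≡0⇒≡ e) Cc
    follow (suc k) e Cc w∈[c,b] with geodesic-step e
    ... | c' , cc' , e' =
      follow k e' (step Cc Cb cc' (between-trans w∈[c,b] c'∈)) (between-shift c'∈ w∈[c,b])
      where
      c'∈ : Between _ w c'
      c'∈ = trans (cong₂ _+_ (d-adj cc') e') (sym e)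

  module _ (s3 : S3) where

    interval-misses-convex : ∀ {C : V → Set} {c w x a} → Convex C → C c → ¬ C w →
                             shadow w c x → C a → ¬ Between w x a
    interval-misses-convex {C} C-convex Cc w∉C w∈ Ca a∈ with s3 C _ C-convex w∉C
    ... | H , (H-convex , Hᶜ-convex) , C⊆H , w∉H =
      Hᶜ-convex _ _ w∉H x∉H _ (between⇒interval a∈) (C⊆H _ Ca)
      where
      x∉H : ¬ H _
      x∉H Hx = w∉H (shadow-elim w∈ H-convex (C⊆H _ Cc) Hx)

    neighbour-equidistant : ∀ {u a w x} → Convex (Between x a) → ¬ Between x a w →
                            ¬ Between u a w → Adj a w → shadow w u x → d u w ≡ d u a
    neighbour-equidistant {u} {a} {w} [x,a]-convex w∉[x,a] w∉[u,a] aw w∈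
      with neighbour-trichotomy {u} aw
    ... | inj₁ further = ⊥-elim (a∉[w,u] (between-sym a∈[u,w]))
      where
      a∉[w,u] : ¬ Between w u a
      a∉[w,u] = interval-misses-convex [x,a]-convex between-left w∉[x,a]
                                       (shadow-swap w∈) between-right
      a∈[u,w] : Between u w a
      a∈[u,w] = trans (d-step aw) (sym further)
    ... | inj₂ (inj₁ closer) = ⊥-elim (w∉[u,a] w∈[u,a])
      where
      w∈[u,a] : Between u a w
      w∈[u,a] = trans (d-step (Adj-sym aw)) closer
    ... | inj₂ (inj₂ equal) = equal

    neighbour-in-interval : ∀ {u x a w} → Convex (Between u a) → Convex (Between x a) →
                            Between u x a → Adj a w → shadow w u x → Between u x w
    neighbour-in-interval {u} {x} {a} {w} [u,a]-convex [x,a]-convex a∈ aw w∈ =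
      decidable-stable (between? u x w) λ w∉ → w∉ (begin
        d u w + d w x  ≡⟨ cong₂ _+_ (equidistant-u w∉) (equidistant-x w∉) ⟩
        d u a + d a x  ≡⟨ a∈ ⟩
        d u x          ∎)
      where
      open ≡-Reasoning
      w∉[u,a] : ¬ Between u x w → ¬ Between u a w
      w∉[u,a] w∉ = w∉ ∘ between-trans a∈
      w∉[x,a] : ¬ Between u x w → ¬ Between x a w
      w∉[x,a] w∉ = w∉ ∘ between-sym ∘ between-trans (between-sym a∈)
      equidistant-u : ¬ Between u x w → d u w ≡ d u a
      equidistant-u w∉ =
        neighbour-equidistant [x,a]-convex (w∉[x,a] w∉) (w∉[u,a] w∉) aw w∈
      equidistant-x : ¬ Between u x w → d w x ≡ d a x
      equidistant-x w∉ = trans (d-sym {w}) (trans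
        (neighbour-equidistant [u,a]-convex (w∉[u,a] w∉) (w∉[x,a] w∉) aw (shadow-swap w∈))
        (d-sym {x}))

    between-convex-step : ∀ {u x} → (∀ {c e} → d c e < d u x → Convex (Between c e)) →
                          Convex (Between u x)
    between-convex-step {u} {x} ih = convex-by-steps (Between u x) step
      where
      step : ∀ {a b a'} → Between u x a → Between u x b → Adj a a' → Between a b a' →
             Between u x a'
      step {a} {b} {a'} a∈ b∈ aa' a'∈ with d u a ≟ 0 | d a x ≟ 0
      ... | yes ua≡0 | _ with refl ← d≡0⇒≡ ua≡0 = between-trans b∈ a'∈
      ... | no _ | yes ax≡0 with refl ← d≡0⇒≡ ax≡0 =
        between-sym (between-trans (between-sym b∈) a'∈)
      ... | no ua≢0 | no ax≢0 = neighbour-in-interval (ih ua<ux) (ih xa<ux) a∈ aa' a'∈conv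
        where
        ua<ux : d u a < d u x
        ua<ux = subst (d u a <_) a∈ (m<m+n (d u a) (n≢0⇒n>0 ax≢0))
        xa<ux : d x a < d u x
        xa<ux = subst₂ _<_ (d-sym {a}) a∈ (m<n+m (d a x) (n≢0⇒n>0 ua≢0))
        a'∈conv : shadow a' u x
        a'∈conv = conv-convex (interval⇒shadow (between⇒interval a∈))
                              (interval⇒shadow (between⇒interval b∈)) (between⇒interval a'∈)

    between-convex : ∀ u x → Convex (Between u x)
    between-convex u x =
      <-rec P (λ _ ih → λ { refl → between-convex-step (λ lt → ih lt refl) }) (d u x) refl
      where
      P : ℕ → Set
      P n = ∀ {u x} → d u x ≡ n → Convex (Between u x)

    shadow⇒between : ∀ {w u x} → shadow w u x → Between u x w
    shadow⇒between w∈ = shadow-elim w∈ (between-convex _ _) between-left between-right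

    shadow⇒interval : ∀ {w u x} → shadow w u x → Interval u x w
    shadow⇒interval = between⇒interval ∘ shadow⇒between

    interval? : ∀ u x w → Dec (Interval u x w)
    interval? u x w = map′ between⇒interval interval⇒between (between? u x w)

    shadow-antisym : ∀ {x0 y z} → shadow y x0 z → shadow z x0 y → y ≡ z
    shadow-antisym y∈ z∈ = between-antisym (shadow⇒between y∈) (shadow⇒between z∈)

module Proximality (G : Graph) (em : ExcludedMiddle (lsuc 0ℓ)) (conn : GraphTheory.Connected G)
                   (s3 : GraphTheory.S3 G) (x0 : GraphTheory.V G) where
  open GraphTheory G hiding (sym)
  open Convexity G

  em₀ : ExcludedMiddle 0ℓ
  em₀ = em-lower (lsuc 0ℓ) em

  open Metric G em₀ conn

  Adjoin : ∀ {ℓ} → (V → Set ℓ) → V → V → Set ℓ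
  Adjoin A y u = A u ⊎ u ≡ y

  Adjoin⊆ : ∀ {ℓ} {A : V → Set ℓ} {C : V → Set} {y} →
            A ⊆ C → C y → Adjoin A y ⊆ C
  Adjoin⊆ A⊆C Cy u (inj₁ Au)   = A⊆C u Au
  Adjoin⊆ A⊆C Cy _ (inj₂ refl) = Cy

  proximal : ∀ {A} → A ⊆ Imp x0 A → ¬ conv A x0 → Proximal x0 A
  proximal A⊆Imp x0∉ = A⊆Imp , (λ _ → proj₁) , x0∉

  proximal-unique : ∀ {K y z} → Proximal x0 K → K z → K y → shadow y x0 z → y ≡ z
  proximal-unique (K⊆Imp , _) Kz Ky y∈ = proj₂ (K⊆Imp _ Kz) _ (shadow⇒interval s3 y∈) Ky

  Imp-anti : ∀ {A B} → B ⊆ A → A ⊆ Imp x0 A → B ⊆ Imp x0 B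
  Imp-anti B⊆A A⊆Imp u Bu =
    Bu , λ w w∈ Bw → proj₂ (A⊆Imp u (B⊆A u Bu)) w w∈ (B⊆A w Bw)

  Imp-adjoin : ∀ {A y} → A ⊆ Imp x0 A → (∀ u → A u → ¬ Interval x0 u y) →
               (∀ w → A w → ¬ Interval x0 y w) → Adjoin A y ⊆ Imp x0 (Adjoin A y)
  Imp-adjoin {A} {y} A⊆Imp y∉ A∉ u u∈ = u∈ , unique u∈
    where
    unique : ∀ {u} → Adjoin A y u → ∀ w → Interval x0 u w → Adjoin A y w → w ≡ u
    unique (inj₁ Au)   w w∈ (inj₁ Aw)   = proj₂ (A⊆Imp _ Au) w w∈ Aw
    unique (inj₁ Au)   _ y∈ (inj₂ refl) = ⊥-elim (y∉ _ Au y∈)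
    unique (inj₂ refl) w w∈ (inj₁ Aw)   = ⊥-elim (A∉ w Aw w∈)
    unique (inj₂ refl) _ _  (inj₂ refl) = refl

  max⇒facet : ∀ {K} → InMax x0 K → Facet x0 K
  max⇒facet {K} (K-proximal , K-max) = K-proximal , λ K' K'-proximal K⊆K' z K'z →
    let (y , Ky , y∈) = K-max K' K'-proximal (λ z Kz → z , K⊆K' z Kz , shadow-refl) z K'z
    in subst K (proximal-unique K'-proximal K'z (K⊆K' y Ky) y∈) Ky

  max⇒condition : ∀ {K} → InMax x0 K → Condition x0 K
  max⇒condition {K} (K-proximal , K-max) y y∉K (z , Kz , y∈) = em⇒dne em (y∉K ∘ y∈K)
    where
    K∖R∪y : V → Set₁
    K∖R∪y = Adjoin (λ u → K u × ¬ shadow y x0 u) y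
    -- R described by intervals instead of shadows, so that K₁ lives in V → Set
    K∖R : V → Set
    K∖R u = K u × ¬ Interval x0 u y
    K₁ : V → Set
    K₁ = Adjoin K∖R y
    K₁⊆K∖R∪y : K₁ ⊆ K∖R∪y
    K₁⊆K∖R∪y _ (inj₁ (Ku , y∉)) = inj₁ (Ku , y∉ ∘ shadow⇒interval s3)
    K₁⊆K∖R∪y _ (inj₂ u≡y)       = inj₂ u≡y
    K∖R∉[x0,y] : ∀ w → K∖R w → ¬ Interval x0 y w
    K∖R∉[x0,y] w (Kw , y∉) w∈ =
      y∉ (subst (λ v → Interval x0 v y) (sym w≡z) (shadow⇒interval s3 y∈))
      where
      w≡z : w ≡ z
      w≡z = proximal-unique K-proximal Kz Kw (shadow-trans (interval⇒shadow w∈) y∈)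
    K₁-proximal : ¬ conv K∖R∪y x0 → Proximal x0 K₁
    K₁-proximal x0∉ = proximal
      (Imp-adjoin (Imp-anti (λ _ → proj₁) (proj₁ K-proximal)) (λ _ → proj₂) K∖R∉[x0,y])
      (x0∉ ∘ conv-mono K₁⊆K∖R∪y x0)
    K⪯K₁ : K ⪯[ x0 ] K₁
    K⪯K₁ u Ku with interval? s3 x0 u y
    ... | yes y∈[x0,u] = y , inj₂ refl , interval⇒shadow y∈[x0,u]
    ... | no y∉[x0,u]  = u , inj₁ (Ku , y∉[x0,u]) , shadow-refl
    y∈K : ¬ conv K∖R∪y x0 → K y
    y∈K x0∉ with K-max K₁ (K₁-proximal x0∉) K⪯K₁ y (inj₂ refl)
    ... | k , Kk , k∈ = subst K (shadow-antisym s3 z∈ y∈) Kz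
      where
      z∈ : shadow z x0 y
      z∈ = subst (λ v → shadow v x0 y)
                 (proximal-unique K-proximal Kz Kk (shadow-trans k∈ y∈)) k∈

  ⪯-halfspace : ∀ {K K' H} → Convex (λ v → ¬ H v) → ¬ H x0 → K' ⊆ H →
                K ⪯[ x0 ] K' → K ⊆ H
  ⪯-halfspace Hᶜ-convex x0∉H K'⊆H K⪯K' z Kz = em⇒dne em₀ λ z∉H →
    let (y , K'y , y∈) = K⪯K' z Kz in shadow-elim y∈ Hᶜ-convex x0∉H z∉H (K'⊆H y K'y)

  convex⊆shadow : ∀ {K H} → Facet x0 K → Condition x0 K →
                  Convex H → ¬ H x0 → K ⊆ H → H ⊆ shadowSet K x0
  convex⊆shadow {K} {H} (K-proximal , K-facet) K-condition H-convex x0∉H K⊆H y Hy =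
    em⇒dne em λ y∉K/x0 → y∉K/x0 (y , y∈K y∉K/x0 , shadow-refl)
    where
    y∈K : ¬ shadowSet K x0 y → K y
    y∈K y∉K/x0 = K-facet (Adjoin K y) K+y-proximal (λ _ → inj₁) y (inj₂ refl)
      where
      y∉K : ¬ K y
      y∉K Ky = y∉K/x0 (y , Ky , shadow-refl)
      R-empty : ¬ ∃ λ z → K z × shadow y x0 z
      R-empty R≠∅ =
        x0∉H (K-condition y y∉K R≠∅ H H-convex (Adjoin⊆ (λ u → K⊆H u ∘ proj₁) Hy))
      K+y-proximal : Proximal x0 (Adjoin K y)
      K+y-proximal = proximal
        (Imp-adjoin (proj₁ K-proximal)
                    (λ u Ku y∈ → R-empty (u , Ku , interval⇒shadow y∈))
                    (λ w Kw w∈ → y∉K/x0 (w , Kw , interval⇒shadow w∈)))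
        (λ x0∈ → x0∉H (x0∈ H H-convex (Adjoin⊆ K⊆H Hy)))

  facet×condition⇒max : ∀ {K} → Facet x0 K × Condition x0 K → InMax x0 K
  facet×condition⇒max {K} (K-facet , K-condition) = proj₁ K-facet , maximal
    where
    maximal : ∀ K' → Proximal x0 K' → K ⪯[ x0 ] K' → K' ⪯[ x0 ] K
    maximal K' (_ , _ , x0∉) K⪯K' y K'y with separate-from-conv s3 x0∉
    ... | H , (H-convex , Hᶜ-convex) , K'⊆H , x0∉H =
      convex⊆shadow K-facet K-condition H-convex x0∉H
                    (⪯-halfspace Hᶜ-convex x0∉H K'⊆H K⪯K') y (K'⊆H y K'y)

proposition3p20 : ExcludedMiddle (lsuc 0ℓ) → (G : Graph) →
    let open GraphTheory G in
    Connected → S3 → (x0 : V) (K : V → Set) →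
    InMax x0 K ⇔ (Facet x0 K × Condition x0 K)
proposition3p20 em G conn s3 x0 K =
  mk⇔ (λ K-max → max⇒facet K-max , max⇒condition K-max) facet×condition⇒max
  where open Proximality G em conn s3 x0
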